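{- Let $n\ge 1$ and let $k,\ell$ be integers with $1\le k<\ell$. If $pre_k$ is injective on the set of partitions of $n$ with exactly $\ell$ parts, then $pre_{\ell-k}$ is also injective on the set of partitions of $n$ with exactly $\ell$ parts.
   Context: A partition $\lambda=(\lambda_1,\dots,\lambda_\ell)$ of $n$ is a non-increasing sequence of positive integers summing to $n$; $\ell$ is its number of parts. For $k\ge 1$, $pre_k(\lambda)$ is the partition whose multiset of parts is $\{\lambda_{i_1}\lambda_{i_2}\cdots\lambda_{i_k} : 1\le i_1<i_2<\cdots<i_k\le \ell\}$ if $\ell\ge k$, and is the empty partition if $\ell<k$. -}

module Defs where

open import Data.Nat using (ℕ; zero; suc; _≥_; _>_)
open import Data.List using (List; []; _∷_; map; _++_; length)
open import Data.Nat.ListAction using (sum; product)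
open import Data.List.Relation.Unary.All using (All)
open import Data.List.Relation.Unary.Linked using (Linked)
open import Data.List.Relation.Binary.Permutation.Propositional using (_↭_)
open import Data.Product using (_×_)
open import Relation.Binary.PropositionalEquality using (_≡_)

IsPartition : ℕ → List ℕ → Set
IsPartition n λs = Linked _≥_ λs × All (λ x → x > 0) λs × sum λs ≡ n

IsPartitionWithParts : ℕ → ℕ → List ℕ → Set
IsPartitionWithParts n ℓ λs = IsPartition n λs × length λs ≡ ℓ

-- All index-subsets of size k (i₁ < … < iₖ), returned as the sublists of entries.
choose : ℕ → List ℕ → List (List ℕ)
choose zero    _        = [] ∷ []
choose (suc k) []       = []
choose (suc k) (x ∷ xs) = map (x ∷_) (choose k xs) ++ choose (suc k) xs

-- Multiset of parts of pre_k(λ) (as a list; taken up to permutation).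
-- Empty if λ has fewer than k parts, as choose then returns [].
pre : ℕ → List ℕ → List ℕ
pre k λs = map product (choose k λs)

-- pre_k is injective on partitions of n with exactly ℓ parts.
-- Two partitions pre_k(λ), pre_k(μ) are equal iff their part-multisets agree (↭).
PreInjective : ℕ → ℕ → ℕ → Set
PreInjective k n ℓ = ∀ (λs μs : List ℕ) → IsPartitionWithParts n ℓ λs → IsPartitionWithParts n ℓ μs →
  pre k λs ↭ pre k μs → λs ≡ μs

{-# OPTIONS --safe #-}
module Submission where

-- Every entry of a list of length ℓ lies in exactly C(ℓ-1, j-1) of its j-element
-- sublists, so the product of all parts of pre_j(λ) is (∏λ)^C(ℓ-1,j-1) and pre_j(λ)
-- determines ∏λ when j ≥ 1. Taking complements pairs the j-sublists with the
-- (ℓ-j)-sublists, whose products are ∏λ divided by those of the former. Hence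
-- pre_{ℓ-k}(λ) determines pre_k(λ), and injectivity of pre_k transfers to pre_{ℓ-k}.

open import Defs
open import Data.Nat
  using (ℕ; zero; suc; _+_; _*_; _^_; _∸_; _≤_; _<_; _>_; pred; NonZero; >-nonZero; ≢-nonZero⁻¹; z<s; s≤s)
open import Data.Nat.Properties
open import Data.Nat.DivMod using (_/_; m*n/n≡m)
open import Data.Nat.Combinatorics using (_C_; nCk+nC[k+1]≡[n+1]C[k+1])
open import Data.Nat.ListAction using (product)
open import Data.Nat.ListAction.Properties using (product-↭; product-++; product≢0)
open import Data.List using (List; []; _∷_; [_]; map; _++_; length)
open import Data.List.Properties using (map-++; map-∘; map-cong-local; length-map; length-++)
open import Data.List.Relation.Unary.All as All using (All; []; _∷_)
import Data.List.Relation.Unary.All.Properties as All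
open import Data.List.Relation.Binary.Permutation.Propositional
  using (_↭_; ↭-refl; ↭-reflexive; ↭-prep; ↭-trans; module PermutationReasoning)
open import Data.List.Relation.Binary.Permutation.Propositional.Properties
  using (++⁺; ++-comm; ++-identityʳ; map⁺; shift)
open import Data.Product using (_×_; _,_; proj₁; proj₂; map₁; map₂)
open import Function using (_∘_)
open import Relation.Binary.Definitions using (tri<; tri≈; tri>)
open import Relation.Binary.PropositionalEquality
  using (_≡_; refl; sym; trans; cong; cong₂; subst; module ≡-Reasoning)
open import Relation.Nullary using (contradiction)
open import Algebra.Properties.CommutativeSemigroup *-commutativeSemigroup using (interchange)

^-distrib-* : ∀ m n o → (m * n) ^ o ≡ m ^ o * n ^ o
^-distrib-* m n zero    = refl
^-distrib-* m n (suc o) = trans (cong (m * n *_) (^-distrib-* m n o)) (interchange m n (m ^ o) (n ^ o))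

^-cancelʳ-≡ : ∀ m n o .{{_ : NonZero o}} → m ^ o ≡ n ^ o → m ≡ n
^-cancelʳ-≡ m n o eq with <-cmp m n
... | tri< m<n _ _ = contradiction eq (<⇒≢ (^-monoˡ-< o m<n))
... | tri≈ _ m≡n _ = m≡n
... | tri> _ _ m>n = contradiction eq (>⇒≢ (^-monoˡ-< o m>n))

k≤n⇒nCk>0 : ∀ {n k} → k ≤ n → n C k > 0
k≤n⇒nCk>0 {n}     {zero}  _         = z<s
k≤n⇒nCk>0 {suc n} {suc k} (s≤s k≤n) =
  subst (_> 0) (nCk+nC[k+1]≡[n+1]C[k+1] n k) (<-≤-trans (k≤n⇒nCk>0 k≤n) (m≤m+n _ _))

-- Division made total by m ÷ 0 = 0, so that it can be mapped over a list of divisors.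
_÷_ : ℕ → ℕ → ℕ
m ÷ zero  = 0
m ÷ suc n = m / suc n

m*n≡o⇒o÷m≡n : ∀ {m n o} .{{_ : NonZero o}} → m * n ≡ o → o ÷ m ≡ n
m*n≡o⇒o÷m≡n {zero}      {o = o} refl = contradiction refl (≢-nonZero⁻¹ o)
m*n≡o⇒o÷m≡n {suc m} {n}         refl = trans (cong (_/ suc m) (*-comm (suc m) n)) (m*n/n≡m n (suc m))

product-map-* : ∀ x ys → product (map (x *_) ys) ≡ x ^ length ys * product ys
product-map-* x []       = refl
product-map-* x (y ∷ ys) =
  trans (cong (x * y *_) (product-map-* x ys)) (interchange x y (x ^ length ys) (product ys))

length-choose : ∀ k xs → length (choose k xs) ≡ length xs C k
length-choose zero    xs       = refl
length-choose (suc k) []       = refl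
length-choose (suc k) (x ∷ xs) = begin
  length (map (x ∷_) (choose k xs) ++ choose (suc k) xs)
    ≡⟨ length-++ (map (x ∷_) (choose k xs)) ⟩
  length (map (x ∷_) (choose k xs)) + length (choose (suc k) xs)
    ≡⟨ cong₂ _+_ (trans (length-map (x ∷_) (choose k xs)) (length-choose k xs)) (length-choose (suc k) xs) ⟩
  length xs C k + length xs C suc k
    ≡⟨ nCk+nC[k+1]≡[n+1]C[k+1] (length xs) k ⟩
  suc (length xs) C suc k ∎
  where open ≡-Reasoning

length<k⇒choose≡[] : ∀ k xs → length xs < k → choose k xs ≡ []
length<k⇒choose≡[] (suc k)       []       _         = refl
length<k⇒choose≡[] (suc (suc k)) (x ∷ xs) (s≤s |xs|<1+k) =
  cong₂ _++_ (cong (map (x ∷_)) (length<k⇒choose≡[] (suc k) xs |xs|<1+k))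
             (length<k⇒choose≡[] (suc (suc k)) xs (m<n⇒m<1+n |xs|<1+k))

choose-length : ∀ xs → choose (length xs) xs ≡ [ xs ]
choose-length []       = refl
choose-length (x ∷ xs) =
  cong₂ _++_ (cong (map (x ∷_)) (choose-length xs)) (length<k⇒choose≡[] (suc (length xs)) xs ≤-refl)

pre-suc-∷ : ∀ k x xs → pre (suc k) (x ∷ xs) ≡ map (x *_) (pre k xs) ++ pre (suc k) xs
pre-suc-∷ k x xs = begin
  map product (map (x ∷_) (choose k xs) ++ choose (suc k) xs)
    ≡⟨ map-++ product (map (x ∷_) (choose k xs)) (choose (suc k) xs) ⟩
  map product (map (x ∷_) (choose k xs)) ++ pre (suc k) xs
    ≡⟨ cong (_++ pre (suc k) xs) (trans (sym (map-∘ (choose k xs))) (map-∘ (choose k xs))) ⟩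
  map (x *_) (pre k xs) ++ pre (suc k) xs ∎
  where open ≡-Reasoning

length-pre : ∀ k xs → length (pre k xs) ≡ length xs C k
length-pre k xs = trans (length-map product (choose k xs)) (length-choose k xs)

product-pre-1 : ∀ xs → product (pre 1 xs) ≡ product xs
product-pre-1 []       = refl
product-pre-1 (x ∷ xs) = cong₂ _*_ (*-identityʳ x) (product-pre-1 xs)

product-pre-suc-∷ : ∀ k x xs →
  product (pre (suc k) (x ∷ xs)) ≡ x ^ (length xs C k) * product (pre k xs) * product (pre (suc k) xs)
product-pre-suc-∷ k x xs = begin
  product (pre (suc k) (x ∷ xs))
    ≡⟨ cong product (pre-suc-∷ k x xs) ⟩
  product (map (x *_) (pre k xs) ++ pre (suc k) xs)
    ≡⟨ product-++ (map (x *_) (pre k xs)) (pre (suc k) xs) ⟩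
  product (map (x *_) (pre k xs)) * product (pre (suc k) xs)
    ≡⟨ cong (_* product (pre (suc k) xs)) (product-map-* x (pre k xs)) ⟩
  x ^ length (pre k xs) * product (pre k xs) * product (pre (suc k) xs)
    ≡⟨ cong (λ e → x ^ e * product (pre k xs) * product (pre (suc k) xs)) (length-pre k xs) ⟩
  x ^ (length xs C k) * product (pre k xs) * product (pre (suc k) xs) ∎
  where open ≡-Reasoning

product-pre-suc : ∀ k xs → product (pre (suc k) xs) ≡ product xs ^ (pred (length xs) C k)
product-pre-suc k       []                = sym (^-zeroˡ (0 C k))
product-pre-suc zero    xs@(_ ∷ _)        = trans (product-pre-1 xs) (sym (*-identityʳ (product xs)))
product-pre-suc (suc k) (x ∷ [])          = refl
product-pre-suc (suc k) (x ∷ xs@(_ ∷ ys)) = begin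
  product (pre (suc (suc k)) (x ∷ xs))
    ≡⟨ product-pre-suc-∷ (suc k) x xs ⟩
  x ^ B * product (pre (suc k) xs) * product (pre (suc (suc k)) xs)
    ≡⟨ cong₂ (λ a b → x ^ B * a * b) (product-pre-suc k xs) (product-pre-suc (suc k) xs) ⟩
  x ^ B * P ^ (length ys C k) * P ^ (length ys C suc k)
    ≡⟨ *-assoc (x ^ B) (P ^ (length ys C k)) (P ^ (length ys C suc k)) ⟩
  x ^ B * (P ^ (length ys C k) * P ^ (length ys C suc k))
    ≡⟨ cong (x ^ B *_) (^-distribˡ-+-* P (length ys C k) (length ys C suc k)) ⟨
  x ^ B * P ^ (length ys C k + length ys C suc k)
    ≡⟨ cong (λ e → x ^ B * P ^ e) (nCk+nC[k+1]≡[n+1]C[k+1] (length ys) k) ⟩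
  x ^ B * P ^ B
    ≡⟨ ^-distrib-* x P B ⟨
  (x * P) ^ B ∎
  where
  open ≡-Reasoning
  P = product xs
  B = length xs C suc k

pre-↭⇒product≡ : ∀ {k xs ys} → 0 < k → k ≤ length xs → length xs ≡ length ys →
  pre k xs ↭ pre k ys → product xs ≡ product ys
pre-↭⇒product≡ {suc k} {xs} {ys} _ k<|xs| |xs|≡|ys| pre-xs↭pre-ys =
  ^-cancelʳ-≡ (product xs) (product ys) e {{>-nonZero (k≤n⇒nCk>0 (pred-mono-≤ k<|xs|))}} (begin
    product xs ^ e                      ≡⟨ product-pre-suc k xs ⟨
    product (pre (suc k) xs)            ≡⟨ product-↭ pre-xs↭pre-ys ⟩
    product (pre (suc k) ys)            ≡⟨ product-pre-suc k ys ⟩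
    product ys ^ (pred (length ys) C k) ≡⟨ cong (λ n → product ys ^ (pred n C k)) |xs|≡|ys| ⟨
    product ys ^ e                      ∎)
  where
  open ≡-Reasoning
  e = pred (length xs) C k

splits : ℕ → List ℕ → List (List ℕ × List ℕ)
splits zero    xs       = [ ([] , xs) ]
splits (suc k) []       = []
splits (suc k) (x ∷ xs) = map (map₁ (x ∷_)) (splits k xs) ++ map (map₂ (x ∷_)) (splits (suc k) xs)

length<k⇒splits≡[] : ∀ k xs → length xs < k → splits k xs ≡ []
length<k⇒splits≡[] (suc k)       []       _         = refl
length<k⇒splits≡[] (suc (suc k)) (x ∷ xs) (s≤s |xs|<1+k) =
  cong₂ _++_ (cong (map (map₁ (x ∷_))) (length<k⇒splits≡[] (suc k) xs |xs|<1+k))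
             (cong (map (map₂ (x ∷_))) (length<k⇒splits≡[] (suc (suc k)) xs (m<n⇒m<1+n |xs|<1+k)))

splits-↭ : ∀ k xs → All (λ st → proj₁ st ++ proj₂ st ↭ xs) (splits k xs)
splits-↭ zero    xs       = ↭-refl ∷ []
splits-↭ (suc k) []       = []
splits-↭ (suc k) (x ∷ xs) = All.++⁺
  (All.map⁺ (All.map (↭-prep x) (splits-↭ k xs)))
  (All.map⁺ (All.map (λ {st} s++t↭xs → ↭-trans (shift x (proj₁ st) (proj₂ st)) (↭-prep x s++t↭xs))
                     (splits-↭ (suc k) xs)))

map-proj₁-splits : ∀ k xs → map proj₁ (splits k xs) ≡ choose k xs
map-proj₁-splits zero    xs       = refl
map-proj₁-splits (suc k) []       = refl
map-proj₁-splits (suc k) (x ∷ xs) = begin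
  map proj₁ (map (map₁ (x ∷_)) L ++ map (map₂ (x ∷_)) R)
    ≡⟨ map-++ proj₁ (map (map₁ (x ∷_)) L) (map (map₂ (x ∷_)) R) ⟩
  map proj₁ (map (map₁ (x ∷_)) L) ++ map proj₁ (map (map₂ (x ∷_)) R)
    ≡⟨ cong₂ _++_ (trans (sym (map-∘ L)) (map-∘ L)) (sym (map-∘ R)) ⟩
  map (x ∷_) (map proj₁ L) ++ map proj₁ R
    ≡⟨ cong₂ _++_ (cong (map (x ∷_)) (map-proj₁-splits k xs)) (map-proj₁-splits (suc k) xs) ⟩
  choose (suc k) (x ∷ xs) ∎
  where
  open ≡-Reasoning
  L = splits k xs
  R = splits (suc k) xs

map-proj₂-splits-∷ : ∀ k x xs →
  map proj₂ (splits (suc k) (x ∷ xs)) ≡ map proj₂ (splits k xs) ++ map (x ∷_) (map proj₂ (splits (suc k) xs))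
map-proj₂-splits-∷ k x xs = begin
  map proj₂ (map (map₁ (x ∷_)) L ++ map (map₂ (x ∷_)) R)
    ≡⟨ map-++ proj₂ (map (map₁ (x ∷_)) L) (map (map₂ (x ∷_)) R) ⟩
  map proj₂ (map (map₁ (x ∷_)) L) ++ map proj₂ (map (map₂ (x ∷_)) R)
    ≡⟨ cong₂ _++_ (sym (map-∘ L)) (trans (sym (map-∘ R)) (map-∘ R)) ⟩
  map proj₂ L ++ map (x ∷_) (map proj₂ R) ∎
  where
  open ≡-Reasoning
  L = splits k xs
  R = splits (suc k) xs

map-proj₂-splits : ∀ k i xs → length xs ≡ k + i → map proj₂ (splits k xs) ↭ choose i xs
map-proj₂-splits zero    _       xs       refl = ↭-reflexive (sym (choose-length xs))
map-proj₂-splits (suc k) zero    (x ∷ xs) eq   = begin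
  map proj₂ (splits (suc k) (x ∷ xs))
    ≡⟨ map-proj₂-splits-∷ k x xs ⟩
  map proj₂ (splits k xs) ++ map (x ∷_) (map proj₂ (splits (suc k) xs))
    ≡⟨ cong (λ S → map proj₂ (splits k xs) ++ map (x ∷_) (map proj₂ S)) (length<k⇒splits≡[] (suc k) xs |xs|<1+k) ⟩
  map proj₂ (splits k xs) ++ []
    ↭⟨ ++-identityʳ (map proj₂ (splits k xs)) ⟩
  map proj₂ (splits k xs)
    ↭⟨ map-proj₂-splits k zero xs |xs|≡k+0 ⟩
  [ [] ] ∎
  where
  open PermutationReasoning
  |xs|≡k+0 = suc-injective eq
  |xs|<1+k = subst (_< suc k) (sym (trans |xs|≡k+0 (+-identityʳ k))) ≤-refl
map-proj₂-splits (suc k) (suc i) (x ∷ xs) eq   = begin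
  map proj₂ (splits (suc k) (x ∷ xs))
    ≡⟨ map-proj₂-splits-∷ k x xs ⟩
  map proj₂ (splits k xs) ++ map (x ∷_) (map proj₂ (splits (suc k) xs))
    ↭⟨ ++⁺ (map-proj₂-splits k (suc i) xs (suc-injective eq))
           (map⁺ (x ∷_) (map-proj₂-splits (suc k) i xs (trans (suc-injective eq) (+-suc k i)))) ⟩
  choose (suc i) xs ++ map (x ∷_) (choose i xs)
    ↭⟨ ++-comm (choose (suc i) xs) (map (x ∷_) (choose i xs)) ⟩
  choose (suc i) (x ∷ xs) ∎
  where open PermutationReasoning

pre-complement : ∀ i j {xs} → All (_> 0) xs → length xs ≡ j + i →
  pre i xs ↭ map (product xs ÷_) (pre j xs)
pre-complement i j {xs} xs>0 |xs|≡j+i = begin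
  map product (choose i xs)
    ↭⟨ map⁺ product (map-proj₂-splits j i xs |xs|≡j+i) ⟨
  map product (map proj₂ S)
    ≡⟨ map-∘ S ⟨
  map (product ∘ proj₂) S
    ≡⟨ map-cong-local (All.map (λ {st} → cofactor {st}) (splits-↭ j xs)) ⟩
  map ((product xs ÷_) ∘ product ∘ proj₁) S
    ≡⟨ trans (map-∘ S) (cong (map (product xs ÷_)) (map-∘ S)) ⟩
  map (product xs ÷_) (map product (map proj₁ S))
    ≡⟨ cong (map (product xs ÷_) ∘ map product) (map-proj₁-splits j xs) ⟩
  map (product xs ÷_) (pre j xs) ∎
  where
  open PermutationReasoning
  S = splits j xs
  instance
    _ = product≢0 (All.map >-nonZero xs>0)
  cofactor : ∀ {st} → proj₁ st ++ proj₂ st ↭ xs → product (proj₂ st) ≡ product xs ÷ product (proj₁ st)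
  cofactor {s , t} s++t↭xs = sym (m*n≡o⇒o÷m≡n {product s} (trans (sym (product-++ s t)) (product-↭ s++t↭xs)))

pre-↭-complement : ∀ {i j xs ys} → 0 < j → All (_> 0) xs → All (_> 0) ys →
  length xs ≡ j + i → length ys ≡ j + i → pre j xs ↭ pre j ys → pre i xs ↭ pre i ys
pre-↭-complement {i} {j} {xs} {ys} 0<j xs>0 ys>0 |xs|≡j+i |ys|≡j+i pre-j-xs↭pre-j-ys = begin
  pre i xs                       ↭⟨ pre-complement i j xs>0 |xs|≡j+i ⟩
  map (product xs ÷_) (pre j xs) ≡⟨ cong (λ P → map (P ÷_) (pre j xs)) product-xs≡product-ys ⟩
  map (product ys ÷_) (pre j xs) ↭⟨ map⁺ (product ys ÷_) pre-j-xs↭pre-j-ys ⟩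
  map (product ys ÷_) (pre j ys) ↭⟨ pre-complement i j ys>0 |ys|≡j+i ⟨
  pre i ys                       ∎
  where
  open PermutationReasoning
  product-xs≡product-ys : product xs ≡ product ys
  product-xs≡product-ys = pre-↭⇒product≡ 0<j (subst (j ≤_) (sym |xs|≡j+i) (m≤m+n j i))
    (trans |xs|≡j+i (sym |ys|≡j+i)) pre-j-xs↭pre-j-ys

theorem1p5 : (n k ℓ : ℕ) → 1 ≤ n → 1 ≤ k → k < ℓ →
    PreInjective k n ℓ → PreInjective (ℓ ∸ k) n ℓ
theorem1p5 n k ℓ _ _ k<ℓ pre-k-injective
  λs μs λs-part@((_ , λs>0 , _) , |λs|≡ℓ) μs-part@((_ , μs>0 , _) , |μs|≡ℓ) =
  pre-k-injective λs μs λs-part μs-part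
    ∘ pre-↭-complement (m<n⇒0<n∸m k<ℓ) λs>0 μs>0 (trans |λs|≡ℓ ℓ≡ℓ∸k+k) (trans |μs|≡ℓ ℓ≡ℓ∸k+k)
  where
  ℓ≡ℓ∸k+k : ℓ ≡ ℓ ∸ k + k
  ℓ≡ℓ∸k+k = sym (m∸n+n≡m (<⇒≤ k<ℓ))
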